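{- Let $\boldsymbol u$ be a faux-bonacci $\omega$-word and, for $n\ge2$, let $w_n=y_nF_n$ be the shortest prefix of $\boldsymbol u$ ending in $F_n$. Then for every $n\ge2$, $w_{n+1}\in\{\alpha(w_n),\beta(w_n)\}$, where $\alpha,\beta$ are applied with index $n$, i.e. $w_{n+1}\in\{y_nF_{n+1},\ y_nF_{n-1}F_{n+1}\}$.
   Context: The finite Fibonacci words are $F_0=0$, $F_1=01$, $F_{n+2}=F_{n+1}F_n$. $\pi(w)=[|w|_0,|w|_1]$ is the Parikh vector, compared componentwise. For $n\ge1$ and a word $w=yF_n$ with $\pi(y)\le\pi(F_n)-\pi(0)$, $\alpha(w)=yF_{n+1}$ and $\beta(w)=yF_{n-1}F_{n+1}$ (for the words $w_n$ above, $\pi(y_n)\le\pi(F_n)-\pi(0)$ holds). For non-empty $X$, $X^-$ is $X$ with its last letter erased; a $4^-$-power is $XXXX^-$ with $X$ non-empty; a binary word is faux-bonacci if it has no factor $11$ and no factor that is a $4^-$-power. -}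

module Defs where

open import Data.Nat using (ℕ; zero; suc; _+_; _∸_; _<_)
open import Data.List using (List; []; _∷_; _++_; length)
open import Data.Product using (Σ; ∃; _×_)
open import Relation.Binary.PropositionalEquality using (_≡_)
open import Relation.Nullary using (¬_)

data Letter : Set where
  𝟎 𝟏 : Letter

Word : Set
Word = List Letter

ωWord : Set
ωWord = ℕ → Letter

F : ℕ → Word
F zero = 𝟎 ∷ []
F (suc zero) = 𝟎 ∷ 𝟏 ∷ []
F (suc (suc n)) = F (suc n) ++ F n

_⁻ : Word → Word
[] ⁻ = []
(a ∷ []) ⁻ = []
(a ∷ b ∷ xs) ⁻ = a ∷ ((b ∷ xs) ⁻)

Is4⁻Power : Word → Set
Is4⁻Power v = Σ Word λ X → ¬ (X ≡ []) × (v ≡ X ++ X ++ X ++ (X ⁻))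

slice : ωWord → ℕ → ℕ → Word
slice u i zero = []
slice u i (suc k) = u i ∷ slice u (suc i) k

pref : ωWord → ℕ → Word
pref u k = slice u 0 k

Factorω : Word → ωWord → Set
Factorω v u = Σ ℕ λ i → v ≡ slice u i (length v)

FauxBonacciω : ωWord → Set
FauxBonacciω u =
  ¬ Factorω (𝟏 ∷ 𝟏 ∷ []) u × (∀ v → Factorω v u → ¬ Is4⁻Power v)

Suffix : Word → Word → Set
Suffix v w = Σ Word λ z → z ++ v ≡ w

ShortestPrefixEndingIn : ωWord → Word → Word → Set
ShortestPrefixEndingIn u v y =
  (y ++ v ≡ pref u (length (y ++ v)))
  × (∀ m → m < length (y ++ v) → ¬ Suffix v (pref u m))

-- α and β with index n, applied to w = y F n
α : ℕ → Word → Word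
α n y = y ++ F (suc n)

β : ℕ → Word → Word
β n y = y ++ F (n ∸ 1) ++ F (suc n)

module Submission where

-- After a possible leading 1, a faux-bonacci word u is the image φ u′ under the Fibonacci
-- morphism φ : 0 ↦ 01, 1 ↦ 0 of a word u′ that is again faux-bonacci: 11 in u′ would give
-- 000 in u, and a 4⁻-power X X X X⁻ in u′ gives the 4⁻-power φX φX φX (φX)⁻ in u. As
-- F_{n+1} = φ F_n, occurrences of F_{n+1} in u at block boundaries correspond to occurrences
-- of F_n in u′, so two facts follow by induction on n from a letter-by-letter check for F_2:
-- an occurrence of F_n at p extends to one of F_{n+1} at p or at p + |F_{n-1}|, and two
-- occurrences of F_n are at least |F_{n-1}| apart. Applied to the occurrence of F_n ending
-- w_n, the first fact and the minimality of w_n and w_{n+1} leave only α(w_n), β(w_n), or an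
-- occurrence of F_n strictly between the two, which the second fact rules out.

open import Defs
open import Data.Nat using (ℕ; zero; suc; _+_; _≤_; _<_; s≤s)
open import Data.Nat.Properties
  using (+-suc; +-comm; +-assoc; +-identityʳ; m≤n+m; ≤-refl; <-trans; <⇒≤; ≰⇒>;
         ≤-antisym; <⇒≱; ≮⇒≥; m≤n⇒m<n∨m≡n; +-monoˡ-<)
open import Data.List using ([]; _∷_; _++_; length)
open import Data.List.Properties using (length-++; ++-assoc)
open import Data.Product using (∃; _×_; _,_; proj₁; proj₂)
open import Data.Sum using (_⊎_; inj₁; inj₂)
import Data.Sum as Sum
open import Data.Empty using (⊥-elim)
open import Relation.Nullary using (¬_)
open import Relation.Binary.PropositionalEquality
  using (_≡_; _≢_; refl; sym; trans; cong; cong₂; subst; module ≡-Reasoning)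

infix 4 _occursIn_at_
infixr 5 _∷_

data _occursIn_at_ : Word → ωWord → ℕ → Set where
  []  : ∀ {u p} → [] occursIn u at p
  _∷_ : ∀ {u p a x} → u p ≡ a → x occursIn u at suc p → a ∷ x occursIn u at p

module _ {u : ωWord} where

  occurs-++⁺ : ∀ {p x y} → x occursIn u at p → y occursIn u at (p + length x) →
                 x ++ y occursIn u at p
  occurs-++⁺ {p} {[]}    {y} []       hy = subst (y occursIn u at_) (+-identityʳ p) hy
  occurs-++⁺ {p} {a ∷ x} {y} (e ∷ hx) hy =
    e ∷ occurs-++⁺ hx (subst (y occursIn u at_) (+-suc p (length x)) hy)

  occurs-++⁻ : ∀ {p} x y → x ++ y occursIn u at p →
                 x occursIn u at p × y occursIn u at (p + length x)
  occurs-++⁻ {p} []      y h       = [] , subst (y occursIn u at_) (sym (+-identityʳ p)) h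
  occurs-++⁻ {p} (a ∷ x) y (e ∷ h) with occurs-++⁻ x y h
  ... | hx , hy = (e ∷ hx) , subst (y occursIn u at_) (sym (+-suc p (length x))) hy

  occurs-next : ∀ {p} x → x occursIn u at p →
                  x ++ 𝟎 ∷ [] occursIn u at p ⊎ x ++ 𝟏 ∷ [] occursIn u at p
  occurs-next {p} x h with u (p + length x) in e
  ... | 𝟎 = inj₁ (occurs-++⁺ h (e ∷ []))
  ... | 𝟏 = inj₂ (occurs-++⁺ h (e ∷ []))

  slice-occurs : ∀ p k → slice u p k occursIn u at p
  slice-occurs p zero    = []
  slice-occurs p (suc k) = refl ∷ slice-occurs (suc p) k

  occurs⇒≡slice : ∀ {p} x → x occursIn u at p → x ≡ slice u p (length x)
  occurs⇒≡slice []      []      = refl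
  occurs⇒≡slice (a ∷ x) (e ∷ h) = cong₂ _∷_ (sym e) (occurs⇒≡slice x h)

  occurs-unique : ∀ {p} x y → x occursIn u at p → y occursIn u at p →
                    length x ≡ length y → x ≡ y
  occurs-unique {p} x y hx hy eq = begin
    x                        ≡⟨ occurs⇒≡slice x hx ⟩
    slice u p (length x)     ≡⟨ cong (slice u p) eq ⟩
    slice u p (length y)     ≡⟨ sym (occurs⇒≡slice y hy) ⟩
    y                        ∎
    where open ≡-Reasoning

length-slice : ∀ u p k → length (slice u p k) ≡ k
length-slice u p zero    = refl
length-slice u p (suc k) = cong suc (length-slice u (suc p) k)

flip : Letter → Letter
flip 𝟎 = 𝟏
flip 𝟏 = 𝟎

flip-swap : ∀ {a b} → flip a ≡ b → a ≡ flip b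
flip-swap {𝟎} refl = refl
flip-swap {𝟏} refl = refl

φ : Word → Word
φ []      = []
φ (𝟎 ∷ x) = 𝟎 ∷ 𝟏 ∷ φ x
φ (𝟏 ∷ x) = 𝟎 ∷ φ x

φ-++ : ∀ x y → φ (x ++ y) ≡ φ x ++ φ y
φ-++ []      y = refl
φ-++ (𝟎 ∷ x) y = cong (λ w → 𝟎 ∷ 𝟏 ∷ w) (φ-++ x y)
φ-++ (𝟏 ∷ x) y = cong (𝟎 ∷_) (φ-++ x y)

φ-++-++ : ∀ x y z → φ (x ++ y) ++ z ≡ φ x ++ (φ y ++ z)
φ-++-++ x y z = trans (cong (_++ z) (φ-++ x y)) (++-assoc (φ x) (φ y) z)

φ-≢[] : ∀ {x} → x ≢ [] → φ x ≢ []
φ-≢[] {[]}    x≢[] = ⊥-elim (x≢[] refl)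
φ-≢[] {𝟎 ∷ x} _    ()
φ-≢[] {𝟏 ∷ x} _    ()

φ-++𝟎-head : ∀ {u p} x → φ x ++ 𝟎 ∷ [] occursIn u at p → u p ≡ 𝟎
φ-++𝟎-head []      (e ∷ _) = e
φ-++𝟎-head (𝟎 ∷ x) (e ∷ _) = e
φ-++𝟎-head (𝟏 ∷ x) (e ∷ _) = e

φ-⁻ : ∀ X → X ≢ [] → ∃ λ t → φ (X ⁻) ++ 𝟎 ∷ [] ≡ φ X ⁻ ++ t
φ-⁻ []          X≢[] = ⊥-elim (X≢[] refl)
φ-⁻ (𝟎 ∷ [])    _    = [] , refl
φ-⁻ (𝟏 ∷ [])    _    = 𝟎 ∷ [] , refl
φ-⁻ (a ∷ b ∷ X) _    with φ-⁻ (b ∷ X) (λ ())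
φ-⁻ (𝟎 ∷ 𝟎 ∷ X) _ | t , eq = t , cong (λ w → 𝟎 ∷ 𝟏 ∷ w) eq
φ-⁻ (𝟎 ∷ 𝟏 ∷ X) _ | t , eq = t , cong (λ w → 𝟎 ∷ 𝟏 ∷ w) eq
φ-⁻ (𝟏 ∷ 𝟎 ∷ X) _ | t , eq = t , cong (𝟎 ∷_) eq
φ-⁻ (𝟏 ∷ 𝟏 ∷ X) _ | t , eq = t , cong (𝟎 ∷_) eq

φ-4⁻Power : ∀ X → X ≢ [] → ∃ λ t →
  φ (X ++ X ++ X ++ X ⁻) ++ 𝟎 ∷ [] ≡ (φ X ++ φ X ++ φ X ++ φ X ⁻) ++ t
φ-4⁻Power X X≢[] with φ-⁻ X X≢[]
... | t , eq = t , (begin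
  φ (X ++ X ++ X ++ X ⁻) ++ 𝟎 ∷ []          ≡⟨ φ-++-++ X _ _ ⟩
  Y ++ (φ (X ++ X ++ X ⁻) ++ 𝟎 ∷ [])        ≡⟨ cong (Y ++_) (φ-++-++ X _ _) ⟩
  Y ++ Y ++ (φ (X ++ X ⁻) ++ 𝟎 ∷ [])        ≡⟨ cong (λ w → Y ++ Y ++ w) (φ-++-++ X _ _) ⟩
  Y ++ Y ++ Y ++ (φ (X ⁻) ++ 𝟎 ∷ [])        ≡⟨ cong (λ w → Y ++ Y ++ Y ++ w) eq ⟩
  Y ++ Y ++ Y ++ (Y ⁻ ++ t)                 ≡⟨ cong (λ w → Y ++ Y ++ w) (++-assoc Y (Y ⁻) t) ⟨
  Y ++ Y ++ (Y ++ Y ⁻) ++ t                 ≡⟨ cong (Y ++_) (++-assoc Y (Y ++ Y ⁻) t) ⟨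
  Y ++ (Y ++ Y ++ Y ⁻) ++ t                 ≡⟨ ++-assoc Y (Y ++ Y ++ Y ⁻) t ⟨
  (Y ++ Y ++ Y ++ Y ⁻) ++ t                 ∎)
  where
  Y = φ X
  open ≡-Reasoning

F-φ : ∀ n → F (suc n) ≡ φ (F n)
F-φ zero          = refl
F-φ (suc zero)    = refl
F-φ (suc (suc n)) = trans (cong₂ _++_ (F-φ (suc n)) (F-φ n)) (sym (φ-++ (F (suc n)) (F n)))

F-head : ∀ n → ∃ λ t → F n ≡ 𝟎 ∷ t
F-head zero          = [] , refl
F-head (suc zero)    = 𝟏 ∷ [] , refl
F-head (suc (suc n)) with F-head (suc n)
... | t , eq = t ++ F n , cong (_++ F n) eq

Suffix-++ˡ : ∀ {v w} x → Suffix v w → Suffix v (x ++ w)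
Suffix-++ˡ {v} x (z , eq) = x ++ z , trans (++-assoc x z v) (cong (x ++_) eq)

F-suffix : ∀ n → Suffix (𝟎 ∷ 𝟎 ∷ 𝟏 ∷ []) (F (3 + n))
               ⊎ Suffix (𝟎 ∷ 𝟏 ∷ 𝟎 ∷ 𝟏 ∷ 𝟎 ∷ []) (F (3 + n))
F-suffix zero          = inj₁ (𝟎 ∷ 𝟏 ∷ [] , refl)
F-suffix (suc zero)    = inj₂ (𝟎 ∷ 𝟏 ∷ 𝟎 ∷ [] , refl)
F-suffix (suc (suc n)) = Sum.map (Suffix-++ˡ (F (4 + n))) (Suffix-++ˡ (F (4 + n))) (F-suffix n)

suffix-occurs : ∀ {u p v w} y → Suffix v w → w ++ y occursIn u at p → ∃ λ q → v ++ y occursIn u at q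
suffix-occurs {u} {p} {v} y (z , eq) h =
  _ , proj₂ (occurs-++⁻ z (v ++ y)
        (subst (_occursIn u at p) (trans (cong (_++ y) (sym eq)) (++-assoc z v y)) h))

ExtendsF : ℕ → ωWord → Set
ExtendsF n u = ∀ {p} → F (2 + n) occursIn u at p →
  F (3 + n) occursIn u at p ⊎ F (3 + n) occursIn u at (p + length (F (1 + n)))

SpacedF : ℕ → ωWord → Set
SpacedF n u = ∀ {p q} → p < q → F (2 + n) occursIn u at p → F (2 + n) occursIn u at q →
  p + length (F (1 + n)) ≤ q

record FauxBonacci (u : ωWord) : Set where
  field
    no-11        : ∀ p → ¬ (𝟏 ∷ 𝟏 ∷ [] occursIn u at p)
    no-4⁻-power : ∀ p X → X ≢ [] → ¬ (X ++ X ++ X ++ X ⁻ occursIn u at p)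

open FauxBonacci

fauxBonacci : ∀ {u} → FauxBonacciω u → FauxBonacci u
fauxBonacci (no11 , no4⁻) .no-11 p h = no11 (p , occurs⇒≡slice _ h)
fauxBonacci (no11 , no4⁻) .no-4⁻-power p X X≢[] h =
  no4⁻ _ (p , occurs⇒≡slice _ h) (X , X≢[] , refl)

module _ {u : ωWord} (faux : FauxBonacci u) where

  after-𝟏 : ∀ {p} → u p ≡ 𝟏 → u (suc p) ≡ 𝟎
  after-𝟏 {p} e with u (suc p) in e′
  ... | 𝟎 = refl
  ... | 𝟏 = ⊥-elim (no-11 faux p (e ∷ e′ ∷ []))

  before-𝟏 : ∀ {p} → u (suc p) ≡ 𝟏 → u p ≡ 𝟎
  before-𝟏 {p} e with u p in e′
  ... | 𝟎 = refl
  ... | 𝟏 = ⊥-elim (no-11 faux p (e′ ∷ e ∷ []))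

  no-000 : ∀ p → ¬ (𝟎 ∷ 𝟎 ∷ 𝟎 ∷ [] occursIn u at p)
  no-000 p = no-4⁻-power faux p (𝟎 ∷ []) (λ ())

  no-0011 : ∀ p → ¬ (𝟎 ∷ 𝟎 ∷ 𝟏 ∷ 𝟏 ∷ [] occursIn u at p)
  no-0011 p (_ ∷ _ ∷ h) = no-11 faux (2 + p) h

  no-010101 : ∀ p → ¬ (𝟎 ∷ 𝟏 ∷ 𝟎 ∷ 𝟏 ∷ 𝟎 ∷ 𝟏 ∷ [] occursIn u at p)
  no-010101 p h with occurs-next (𝟎 ∷ 𝟏 ∷ 𝟎 ∷ 𝟏 ∷ 𝟎 ∷ 𝟏 ∷ []) h
  ... | inj₁ h′ = no-4⁻-power faux p (𝟎 ∷ 𝟏 ∷ []) (λ ()) h′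
  ... | inj₂ (_ ∷ _ ∷ _ ∷ _ ∷ _ ∷ h′) = no-11 faux (5 + p) h′

  F-followed-by-𝟎 : ∀ n {p} → F (3 + n) occursIn u at p → F (3 + n) ++ 𝟎 ∷ [] occursIn u at p
  F-followed-by-𝟎 n h with occurs-next (F (3 + n)) h
  ... | inj₁ h₀ = h₀
  ... | inj₂ h₁ with F-suffix n
  ...   | inj₁ s = ⊥-elim (no-0011 _ (proj₂ (suffix-occurs (𝟏 ∷ []) s h₁)))
  ...   | inj₂ s = ⊥-elim (no-010101 _ (proj₂ (suffix-occurs (𝟏 ∷ []) s h₁)))

  F₂-extends : ExtendsF 0 u
  F₂-extends {p} h with occurs-next (F 2) h
  ... | inj₁ h₀ with occurs-next (F 2 ++ 𝟎 ∷ []) h₀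
  ...   | inj₁ (_ ∷ _ ∷ h₀₀₀) = ⊥-elim (no-000 (2 + p) h₀₀₀)
  ...   | inj₂ h₀₁ = inj₁ h₀₁
  F₂-extends {p} h | inj₂ h₁ with occurs-next (F 2 ++ 𝟏 ∷ []) h₁
  ...   | inj₂ (_ ∷ _ ∷ _ ∷ h₁₁) = ⊥-elim (no-11 faux (3 + p) h₁₁)
  ...   | inj₁ h₁₀ with occurs-next (F 2 ++ 𝟏 ∷ 𝟎 ∷ []) h₁₀
  ...     | inj₂ h₁₀₁ = ⊥-elim (no-010101 p h₁₀₁)
  ...     | inj₁ h₁₀₀ with occurs-next (F 2 ++ 𝟏 ∷ 𝟎 ∷ 𝟎 ∷ []) h₁₀₀
  ...       | inj₁ (_ ∷ _ ∷ _ ∷ _ ∷ h₀₀₀) = ⊥-elim (no-000 (4 + p) h₀₀₀)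
  ...       | inj₂ (_ ∷ _ ∷ h₀₁₀₀₁) = inj₂ (subst (F 3 occursIn u at_) (+-comm 2 p) h₀₁₀₀₁)

  F₂-spaced : SpacedF 0 u
  F₂-spaced {p} {q} p<q (_ ∷ e₁ ∷ _) (e₀′ ∷ _) with m≤n⇒m<n∨m≡n p<q
  ... | inj₁ p+1<q = subst (_≤ q) (+-comm 2 p) p+1<q
  ... | inj₂ refl  with () ← trans (sym e₁) e₀′

ones : Letter → ℕ
ones 𝟎 = 0
ones 𝟏 = 1

-- After a possible leading 1, u is a concatenation of blocks φ 𝟎 = 01 and φ 𝟏 = 0, each
-- starting with a 0 (no 11); block k starts at blockStart k and is φ (desub k).
module Desubstitution {u : ωWord} (faux : FauxBonacci u) where

  skip-𝟏 : ℕ → ℕ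
  skip-𝟏 p = ones (u p) + p

  blockStart : ℕ → ℕ
  blockStart zero    = skip-𝟏 0
  blockStart (suc k) = skip-𝟏 (suc (blockStart k))

  desub : ωWord
  desub k = flip (u (suc (blockStart k)))

  skip-𝟏-𝟎 : ∀ p → u (skip-𝟏 p) ≡ 𝟎
  skip-𝟏-𝟎 p with u p in e
  ... | 𝟎 = e
  ... | 𝟏 = after-𝟏 faux e

  blockStart-𝟎 : ∀ k → u (blockStart k) ≡ 𝟎
  blockStart-𝟎 zero    = skip-𝟏-𝟎 0
  blockStart-𝟎 (suc k) = skip-𝟏-𝟎 _

  next-blockStart : ∀ k {a} → u (suc (blockStart k)) ≡ a → blockStart (suc k) ≡ ones a + suc (blockStart k)
  next-blockStart k = cong (λ a → ones a + suc (blockStart k))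

  blockStart-onto : ∀ p → u p ≡ 𝟎 → ∃ λ k → blockStart k ≡ p
  blockStart-onto zero e = 0 , cong (λ a → ones a + 0) e
  blockStart-onto (suc p) e with u p in e′
  ... | 𝟎 with blockStart-onto p e′
  ...   | k , refl = suc k , next-blockStart k e
  blockStart-onto (suc zero) e    | 𝟏 = 0 , cong (λ a → ones a + 0) e′
  blockStart-onto (suc (suc p)) e | 𝟏 with blockStart-onto p (before-𝟏 faux e′)
  ...   | k , refl = suc k , next-blockStart k e′

  blockStart-suc-φ : ∀ k {a} → desub k ≡ a → blockStart (suc k) ≡ blockStart k + length (φ (a ∷ []))
  blockStart-suc-φ k {a} e = trans (next-blockStart k (flip-swap e)) (ones-flip a)
    where
    ones-flip : ∀ a → ones (flip a) + suc (blockStart k) ≡ blockStart k + length (φ (a ∷ []))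
    ones-flip 𝟎 = +-comm 2 (blockStart k)
    ones-flip 𝟏 = +-comm 1 (blockStart k)

  φ-occurs : ∀ {k} x → x occursIn desub at k → φ x occursIn u at blockStart k
  φ-occurs     []      []      = []
  φ-occurs {k} (𝟎 ∷ x) (e ∷ h) =
    blockStart-𝟎 k ∷ flip-swap e ∷ subst (φ x occursIn u at_) (next-blockStart k (flip-swap e)) (φ-occurs x h)
  φ-occurs {k} (𝟏 ∷ x) (e ∷ h) =
    blockStart-𝟎 k ∷ subst (φ x occursIn u at_) (next-blockStart k (flip-swap e)) (φ-occurs x h)

  blockStart-+ : ∀ {k} x → x occursIn desub at k → blockStart (k + length x) ≡ blockStart k + length (φ x)
  blockStart-+ {k} []      []      = trans (cong blockStart (+-identityʳ k)) (sym (+-identityʳ _))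
  blockStart-+ {k} (a ∷ x) (e ∷ h) = begin
    blockStart (k + suc (length x))                         ≡⟨ cong blockStart (+-suc k (length x)) ⟩
    blockStart (suc k + length x)                           ≡⟨ blockStart-+ x h ⟩
    blockStart (suc k) + length (φ x)                       ≡⟨ cong (_+ length (φ x)) (blockStart-suc-φ k e) ⟩
    blockStart k + length (φ (a ∷ [])) + length (φ x)       ≡⟨ +-assoc (blockStart k) _ _ ⟩
    blockStart k + (length (φ (a ∷ [])) + length (φ x))     ≡⟨ cong (blockStart k +_) length-φ-∷ ⟨
    blockStart k + length (φ (a ∷ x))                       ∎
    where
    open ≡-Reasoning
    length-φ-∷ : length (φ (a ∷ x)) ≡ length (φ (a ∷ [])) + length (φ x)
    length-φ-∷ = trans (cong length (φ-++ (a ∷ []) x)) (length-++ (φ (a ∷ [])))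

  φ-occurs-𝟎 : ∀ {k} x → x occursIn desub at k → φ x ++ 𝟎 ∷ [] occursIn u at blockStart k
  φ-occurs-𝟎 {k} x h =
    occurs-++⁺ (φ-occurs x h)
      (subst (λ p → u p ≡ 𝟎) (blockStart-+ x h) (blockStart-𝟎 (k + length x)) ∷ [])

  desub-occurs : ∀ {k} x → φ x ++ 𝟎 ∷ [] occursIn u at blockStart k → x occursIn desub at k
  desub-occurs     []      _             = []
  desub-occurs {k} (𝟎 ∷ x) (_ ∷ e₁ ∷ h) =
    cong flip e₁ ∷ desub-occurs x (subst (φ x ++ 𝟎 ∷ [] occursIn u at_) (sym (next-blockStart k e₁)) h)
  desub-occurs {k} (𝟏 ∷ x) (_ ∷ h)      =
    cong flip e₁ ∷ desub-occurs x (subst (φ x ++ 𝟎 ∷ [] occursIn u at_) (sym (next-blockStart k e₁)) h)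
    where e₁ = φ-++𝟎-head x h

  desub-faux : FauxBonacci desub
  desub-faux .no-11 k h = no-000 faux (blockStart k) (φ-occurs-𝟎 (𝟏 ∷ 𝟏 ∷ []) h)
  -- The 0 opening the next block completes φ (X ⁻) to a word beginning with φ X ⁻.
  desub-faux .no-4⁻-power k X X≢[] h with φ-4⁻Power X X≢[]
  ... | t , eq = no-4⁻-power faux (blockStart k) (φ X) (φ-≢[] X≢[])
                   (proj₁ (occurs-++⁻ (φ X ++ φ X ++ φ X ++ φ X ⁻) t
                     (subst (_occursIn u at blockStart k) eq (φ-occurs-𝟎 _ h))))

  blockStart-<-suc : ∀ k → blockStart k < blockStart (suc k)
  blockStart-<-suc k = m≤n+m (suc (blockStart k)) _

  blockStart-mono-< : ∀ {k k′} → k < k′ → blockStart k < blockStart k′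
  blockStart-mono-< {k} {suc k′} (s≤s k≤k′) with m≤n⇒m<n∨m≡n k≤k′
  ... | inj₁ k<k′ = <-trans (blockStart-mono-< k<k′) (blockStart-<-suc k′)
  ... | inj₂ refl = blockStart-<-suc k

  blockStart-mono-≤ : ∀ {k k′} → k ≤ k′ → blockStart k ≤ blockStart k′
  blockStart-mono-≤ k≤k′ with m≤n⇒m<n∨m≡n k≤k′
  ... | inj₁ k<k′ = <⇒≤ (blockStart-mono-< k<k′)
  ... | inj₂ refl = ≤-refl

  blockStart-cancel-< : ∀ {k k′} → blockStart k < blockStart k′ → k < k′
  blockStart-cancel-< s<s′ = ≰⇒> (λ k′≤k → <⇒≱ s<s′ (blockStart-mono-≤ k′≤k))

  F-at-blockStart : ∀ n {p} → F n occursIn u at p → ∃ λ k → blockStart k ≡ p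
  F-at-blockStart n {p} h with F-head n
  ... | t , eq with subst (_occursIn u at p) eq h
  ...   | e ∷ _ = blockStart-onto p e

  F-desub : ∀ n k → F (3 + n) occursIn u at blockStart k → F (2 + n) occursIn desub at k
  F-desub n k h = desub-occurs {k} (F (2 + n))
    (subst (λ w → w ++ 𝟎 ∷ [] occursIn u at _) (F-φ (2 + n)) (F-followed-by-𝟎 faux n h))

  F-φ-occurs : ∀ n {k} → F n occursIn desub at k → F (suc n) occursIn u at blockStart k
  F-φ-occurs n h = subst (_occursIn u at _) (sym (F-φ n)) (φ-occurs (F n) h)

  F-blockStart-+ : ∀ n {k} → F (2 + n) occursIn desub at k →
                   blockStart (k + length (F (1 + n))) ≡ blockStart k + length (F (2 + n))
  F-blockStart-+ n {k} h =
    trans (blockStart-+ (F (1 + n)) (proj₁ (occurs-++⁻ (F (1 + n)) (F n) h)))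
          (cong (λ w → blockStart k + length w) (sym (F-φ (1 + n))))

  extendsF-lift : ∀ n → ExtendsF n desub → ExtendsF (suc n) u
  extendsF-lift n extends h with F-at-blockStart (3 + n) h
  ... | k , refl with extends (F-desub n k h)
  ...   | inj₁ h′ = inj₁ (F-φ-occurs (3 + n) h′)
  ...   | inj₂ h′ = inj₂ (subst (F (4 + n) occursIn u at_) (F-blockStart-+ n (F-desub n k h))
                                (F-φ-occurs (3 + n) h′))

  spacedF-lift : ∀ n → SpacedF n desub → SpacedF (suc n) u
  spacedF-lift n spaced p<q hp hq with F-at-blockStart (3 + n) hp | F-at-blockStart (3 + n) hq
  ... | k , refl | k′ , refl =
    subst (_≤ blockStart k′) (F-blockStart-+ n (F-desub n k hp))
      (blockStart-mono-≤ (spaced (blockStart-cancel-< {k} {k′} p<q) (F-desub n k hp) (F-desub n k′ hq)))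

extendsF : ∀ n {u} → FauxBonacci u → ExtendsF n u
extendsF zero    faux = F₂-extends faux
extendsF (suc n) faux = extendsF-lift n (extendsF n desub-faux)
  where open Desubstitution faux

spacedF : ∀ n {u} → FauxBonacci u → SpacedF n u
spacedF zero    faux = F₂-spaced faux
spacedF (suc n) faux = spacedF-lift n (spacedF n desub-faux)
  where open Desubstitution faux

module ShortestPrefix {u : ωWord} {v y : Word} (shortest : ShortestPrefixEndingIn u v y) where

  occurs : y ++ v occursIn u at 0
  occurs = subst (_occursIn u at 0) (sym (proj₁ shortest)) (slice-occurs 0 _)

  minimal : ∀ {c} → v occursIn u at c → length y ≤ c
  minimal {c} h = ≮⇒≥ λ c<|y| →
    proj₂ shortest (c + length v) (subst (c + length v <_) (sym (length-++ y)) (+-monoˡ-< (length v) c<|y|))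
      (pref u c , ends-in-v)
    where
    ends-in-v : pref u c ++ v ≡ pref u (c + length v)
    ends-in-v = trans (occurs⇒≡slice _ (occurs-++⁺ (slice-occurs 0 c)
                                          (subst (v occursIn u at_) (sym (length-slice u 0 c)) h)))
                      (cong (pref u) (trans (length-++ (pref u c)) (cong (_+ length v) (length-slice u 0 c))))

  unique : ∀ {x c} → x occursIn u at 0 → v occursIn u at c → length x ≡ c → length y ≡ c →
           y ++ v ≡ x ++ v
  unique {x} hx hv refl eq =
    occurs-unique _ _ occurs (occurs-++⁺ hx hv)
      (trans (length-++ y) (trans (cong (_+ length v) eq) (sym (length-++ x))))

lemma7 : (u : ωWord) → FauxBonacciω u → (n : ℕ) → 2 ≤ n →
    (yₙ yₙ₊₁ : Word) →
    ShortestPrefixEndingIn u (F n) yₙ →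
    ShortestPrefixEndingIn u (F (suc n)) yₙ₊₁ →
    (yₙ₊₁ ++ F (suc n) ≡ α n yₙ) ⊎ (yₙ₊₁ ++ F (suc n) ≡ β n yₙ)
lemma7 u fb (suc (suc n)) (s≤s (s≤s _)) y y′ w w′ = placement (extendsF n faux Fₙ-at-a)
  where
  faux : FauxBonacci u
  faux = fauxBonacci fb
  module Wₙ = ShortestPrefix {y = y} w
  module Wₙ₊₁ = ShortestPrefix {y = y′} w′
  y-at-0 : y occursIn u at 0
  y-at-0 = proj₁ (occurs-++⁻ y (F (2 + n)) Wₙ.occurs)
  Fₙ-at-a : F (2 + n) occursIn u at length y
  Fₙ-at-a = proj₂ (occurs-++⁻ y (F (2 + n)) Wₙ.occurs)
  Fₙ₊₁-at-b : F (3 + n) occursIn u at length y′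
  Fₙ₊₁-at-b = proj₂ (occurs-++⁻ y′ (F (3 + n)) Wₙ₊₁.occurs)
  Fₙ-at-b : F (2 + n) occursIn u at length y′
  Fₙ-at-b = proj₁ (occurs-++⁻ (F (2 + n)) (F (1 + n)) Fₙ₊₁-at-b)
  a≤b : length y ≤ length y′
  a≤b = Wₙ.minimal Fₙ-at-b
  placement : F (3 + n) occursIn u at length y ⊎ F (3 + n) occursIn u at (length y + length (F (1 + n))) →
              (y′ ++ F (3 + n) ≡ y ++ F (3 + n)) ⊎ (y′ ++ F (3 + n) ≡ y ++ F (1 + n) ++ F (3 + n))
  placement (inj₁ h) = inj₁ (Wₙ₊₁.unique y-at-0 h refl (≤-antisym (Wₙ₊₁.minimal h) a≤b))
  placement (inj₂ h) with m≤n⇒m<n∨m≡n a≤b | m≤n⇒m<n∨m≡n (Wₙ₊₁.minimal h)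
  ... | inj₂ a≡b | _        = inj₁ (Wₙ₊₁.unique y-at-0 Fₙ₊₁-at-b a≡b refl)
  ... | inj₁ a<b | inj₁ b<c = ⊥-elim (<⇒≱ b<c (spacedF n faux a<b Fₙ-at-a Fₙ-at-b))
  ... | inj₁ _   | inj₂ b≡c =
    inj₂ (trans (Wₙ₊₁.unique y-Fₙ₋₁-at-0 h (length-++ y) b≡c) (++-assoc y _ _))
    where
    y-Fₙ₋₁-at-0 : y ++ F (1 + n) occursIn u at 0
    y-Fₙ₋₁-at-0 = occurs-++⁺ y-at-0 (proj₁ (occurs-++⁻ (F (1 + n)) (F n) Fₙ-at-a))
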